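{- Let $\Phi$ be any set of formulas and consider the $\Phi$-disjunction tree. For every $k\in\mathbb{N}$, every finite 01-sequence $\bar r$, and every function $f$ on $S_k$ (the set of 01-sequences of length $k$) such that $f(\bar s)$ is an initial segment of $\bar s$ for every $\bar s\in S_k$, we have \[\Phi_{\bar r}\vdash_{\mathbf{SU}}\bigvee\{\alpha_{\bar r f(\bar s)}\mid \bar s\in S_k\}.\]
   Context: Formulas are built from countably many propositional variables and $\bot$ with $\land,\lor,\to$; $\neg\alpha$ abbreviates $\alpha\to\bot$, $\top$ abbreviates $\bot\to\bot$. $\vdash_{\mathbf{SU}}$ is the consequence relation of a Hilbert system for intuitionistic propositional logic (with modus ponens) extended by all substitution instances of $\boldsymbol{su} = ((\neg p\to q)\land(\neg q\to p) \rightarrow r \vee s) \to ( p \rightarrow r) \vee(q \rightarrow s)$ as axioms. For 01-sequences, $\bar s\bar t$ denotes concatenation and $\emptyset$ the empty sequence. Fix an enumeration $\Xi$ of all formulas of the form $\phi\lor\psi$. The $\Phi$-disjunction tree assigns to each finite 01-sequence $\bar s$ a formula $\alpha_{\bar s}$, a set $\Phi_{\bar s}$ and a sequence $\Xi_{\bar s}$ recursively: $\alpha_\emptyset=\top$, $\Phi_\emptyset=\Phi$, $\Xi_\emptyset=\Xi$; given $\bar s$, let $\alpha_{\bar s0}\lor\alpha_{\bar s1}$ be the first formula in $\Xi_{\bar s}$ derivable (by $\vdash_{\mathbf{SU}}$) from $\Phi_{\bar s}$, set $\Phi_{\bar s0}=\Phi_{\bar s}\cup\{\alpha_{\bar s0}\}$,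 $\Phi_{\bar s1}=\Phi_{\bar s}\cup\{\alpha_{\bar s1}\}$, and let $\Xi_{\bar s0}=\Xi_{\bar s1}$ be $\Xi_{\bar s}$ with that formula removed. A finite disjunction $\bigvee$ of a finite set is taken in any fixed order and bracketing. -}

module Defs where

open import Data.Nat using (ℕ; zero; suc; _<_; _<ᵇ_)
open import Data.Bool using (Bool; true; false; if_then_else_)
open import Data.List using (List; []; _∷_; _++_; map; [_]; _∷ʳ_)
open import Data.Vec using (Vec; toList) renaming ([] to []ᵥ; _∷_ to _∷ᵥ_)
open import Data.Product using (Σ; ∃; _×_; _,_; proj₁; proj₂)
open import Data.Sum using (_⊎_)
open import Relation.Binary.PropositionalEquality using (_≡_)
open import Relation.Nullary using (¬_)

infixr 6 _∧_
infixr 5 _∨_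
infixr 4 _⇒_

data Formula : Set where
  var : ℕ → Formula
  ⊥f  : Formula
  _∧_ _∨_ _⇒_ : Formula → Formula → Formula

¬f_ : Formula → Formula
¬f α = α ⇒ ⊥f

⊤f : Formula
⊤f = ⊥f ⇒ ⊥f

sub : (ℕ → Formula) → Formula → Formula
sub σ (var n) = σ n
sub σ ⊥f      = ⊥f
sub σ (a ∧ b) = sub σ a ∧ sub σ b
sub σ (a ∨ b) = sub σ a ∨ sub σ b
sub σ (a ⇒ b) = sub σ a ⇒ sub σ b

su : Formula
su = (((¬f p ⇒ q) ∧ (¬f q ⇒ p)) ⇒ (r ∨ s)) ⇒ ((p ⇒ r) ∨ (q ⇒ s))
  where
  p = var 0
  q = var 1
  r = var 2
  s = var 3

data Axiom : Formula → Set where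
  ax-K    : ∀ a b → Axiom (a ⇒ b ⇒ a)
  ax-S    : ∀ a b c → Axiom ((a ⇒ b ⇒ c) ⇒ (a ⇒ b) ⇒ a ⇒ c)
  ax-∧E₁  : ∀ a b → Axiom (a ∧ b ⇒ a)
  ax-∧E₂  : ∀ a b → Axiom (a ∧ b ⇒ b)
  ax-∧I   : ∀ a b → Axiom (a ⇒ b ⇒ a ∧ b)
  ax-∨I₁  : ∀ a b → Axiom (a ⇒ a ∨ b)
  ax-∨I₂  : ∀ a b → Axiom (b ⇒ a ∨ b)
  ax-∨E   : ∀ a b c → Axiom ((a ⇒ c) ⇒ (b ⇒ c) ⇒ a ∨ b ⇒ c)
  ax-⊥E   : ∀ a → Axiom (⊥f ⇒ a)
  ax-su   : ∀ (σ : ℕ → Formula) → Axiom (sub σ su)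

FSet : Set₁
FSet = Formula → Set

infix 3 _⊢_
data _⊢_ (Γ : FSet) : Formula → Set where
  hyp : ∀ {φ} → Γ φ → Γ ⊢ φ
  ax  : ∀ {φ} → Axiom φ → Γ ⊢ φ
  mp  : ∀ {φ ψ} → Γ ⊢ φ ⇒ ψ → Γ ⊢ φ → Γ ⊢ ψ

-- a disjunction φ ∨ ψ is represented by the pair (φ , ψ)
disj : Formula × Formula → Formula
disj (φ , ψ) = φ ∨ ψ

removeAt : {A : Set} → ℕ → (ℕ → A) → (ℕ → A)
removeAt i X n = if n <ᵇ i then X n else X (suc n)

_⇔_ : Set → Set → Set
A ⇔ B = (A → B) × (B → A)

-- finite 01-sequences are List Bool (false = 0, true = 1);
-- s ∷ʳ b is the extension s̄b.

record IsDisjTree (Φ : FSet) (Ξ : ℕ → Formula × Formula)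
                  (α : List Bool → Formula) (Φs : List Bool → FSet)
                  (Ξs : List Bool → ℕ → Formula × Formula) : Set₁ where
  field
    α-root : α [] ≡ ⊤f
    Φ-root : ∀ φ → Φs [] φ ⇔ Φ φ
    Ξ-root : ∀ n → Ξs [] n ≡ Ξ n
    step   : ∀ s → Σ ℕ λ i →
               (Φs s ⊢ disj (Ξs s i))
             × (∀ j → j < i → ¬ (Φs s ⊢ disj (Ξs s j)))
             × (α (s ∷ʳ false) ≡ proj₁ (Ξs s i))
             × (α (s ∷ʳ true) ≡ proj₂ (Ξs s i))
             × (∀ b φ → Φs (s ∷ʳ b) φ ⇔ (Φs s φ ⊎ φ ≡ α (s ∷ʳ b)))
             × (∀ b n → Ξs (s ∷ʳ b) n ≡ removeAt i (Ξs s) n)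

allSeqs : (k : ℕ) → List (Vec Bool k)
allSeqs zero    = []ᵥ ∷ []
allSeqs (suc k) = map (false ∷ᵥ_) (allSeqs k) ++ map (true ∷ᵥ_) (allSeqs k)

IsPrefix : List Bool → List Bool → Set
IsPrefix u s = ∃ λ v → u ++ v ≡ s

⋁ : List Formula → Formula
⋁ []           = ⊥f
⋁ (x ∷ [])     = x
⋁ (x ∷ y ∷ xs) = x ∨ ⋁ (y ∷ xs)

{-# OPTIONS --safe #-}
module Submission where

-- Induction on k, simultaneously for all r.  For k = 0 the disjunction is just α_r, which
-- lies in Φ_r (or is ⊤ when r is empty).  For k + 1, Φ_r ⊢ α_r0 ∨ α_r1, so it suffices to
-- derive the disjunction from Φ_rb = Φ_r ∪ {α_rb} for each bit b.  The induction hypothesis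
-- at rb for the function s ↦ f(bs) minus its first bit yields a disjunction each of whose
-- members is either a member α_{r f(bs)} of the target disjunction or, when f(bs) is empty,
-- is implied by α_r, which is again a member of the target.

open import Defs
open import Data.Nat using (ℕ; zero; suc)
open import Data.Bool using (Bool; true; false)
open import Data.List using (List; []; _∷_; map; _++_; _∷ʳ_; drop)
open import Data.List.Properties using (++-assoc; ++-identityʳ; ++-conicalˡ; ∷-injective)
open import Data.List.Reverse using (reverseView; []; _∶_∶ʳ_)
open import Data.List.Membership.Propositional using (_∈_)
open import Data.List.Membership.Propositional.Properties using (∈-map⁺; ∈-++⁺ˡ; ∈-++⁺ʳ)
open import Data.List.Relation.Unary.Any using (here; there)
open import Data.List.Relation.Unary.All as All using (All; []; _∷_)
import Data.List.Relation.Unary.All.Properties as All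
open import Data.Vec using (Vec; toList) renaming ([] to []ᵥ; _∷_ to _∷ᵥ_)
open import Data.Product using (_×_; ∃; _,_; proj₁; proj₂)
open import Data.Sum using (_⊎_; inj₁; inj₂)
open import Function using (_∘_)
open import Relation.Binary.PropositionalEquality using (_≡_; refl; sym; subst)

private variable
  Γ Δ : FSet
  φ ψ χ : Formula
  xs : List Formula

module _ {Γ : FSet} where

  ⇒-const : Γ ⊢ φ → Γ ⊢ ψ ⇒ φ
  ⇒-const = mp (ax (ax-K _ _))

  ⇒-refl : Γ ⊢ φ ⇒ φ
  ⇒-refl {φ} = mp (mp (ax (ax-S φ (φ ⇒ φ) φ)) (ax (ax-K _ _))) (ax (ax-K _ _))

  ⇒-trans : Γ ⊢ φ ⇒ ψ → Γ ⊢ ψ ⇒ χ → Γ ⊢ φ ⇒ χ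
  ⇒-trans φ⇒ψ ψ⇒χ = mp (mp (ax (ax-S _ _ _)) (⇒-const ψ⇒χ)) φ⇒ψ

  ∨-elim : Γ ⊢ φ ⇒ χ → Γ ⊢ ψ ⇒ χ → Γ ⊢ φ ∨ ψ → Γ ⊢ χ
  ∨-elim φ⇒χ ψ⇒χ = mp (mp (mp (ax (ax-∨E _ _ _)) φ⇒χ) ψ⇒χ)

  ⋁-intro : φ ∈ xs → Γ ⊢ φ ⇒ ⋁ xs
  ⋁-intro {xs = _ ∷ []}    (here refl) = ⇒-refl
  ⋁-intro {xs = _ ∷ _ ∷ _} (here refl) = ax (ax-∨I₁ _ _)
  ⋁-intro {xs = _ ∷ _ ∷ _} (there φ∈) = ⇒-trans (⋁-intro φ∈) (ax (ax-∨I₂ _ _))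

  ⋁-elim : All (λ φ → Γ ⊢ φ ⇒ χ) xs → Γ ⊢ ⋁ xs ⇒ χ
  ⋁-elim []                  = ax (ax-⊥E _)
  ⋁-elim (φ⇒χ ∷ [])          = φ⇒χ
  ⋁-elim (φ⇒χ ∷ ψ⇒χ ∷ rest) = mp (mp (ax (ax-∨E _ _ _)) φ⇒χ) (⋁-elim (ψ⇒χ ∷ rest))

⊢-mono : (∀ φ → Γ φ → Δ φ) → Γ ⊢ φ → Δ ⊢ φ
⊢-mono Γ⊆Δ (hyp φ∈Γ) = hyp (Γ⊆Δ _ φ∈Γ)
⊢-mono Γ⊆Δ (ax φ-ax)  = ax φ-ax
⊢-mono Γ⊆Δ (mp p q)   = mp (⊢-mono Γ⊆Δ p) (⊢-mono Γ⊆Δ q)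

deduction : (∀ χ → Δ χ → Γ χ ⊎ χ ≡ φ) → Δ ⊢ ψ → Γ ⊢ φ ⇒ ψ
deduction Δ⊆Γ,φ (hyp {χ} χ∈Δ) with Δ⊆Γ,φ χ χ∈Δ
... | inj₁ χ∈Γ = ⇒-const (hyp χ∈Γ)
... | inj₂ refl = ⇒-refl
deduction Δ⊆Γ,φ (ax χ-ax) = ⇒-const (ax χ-ax)
deduction Δ⊆Γ,φ (mp p q)  = mp (mp (ax (ax-S _ _ _)) (deduction Δ⊆Γ,φ p)) (deduction Δ⊆Γ,φ q)

allSeqs-complete : ∀ {k} (s : Vec Bool k) → s ∈ allSeqs k
allSeqs-complete []ᵥ          = here refl
allSeqs-complete (false ∷ᵥ s) = ∈-++⁺ˡ (∈-map⁺ (false ∷ᵥ_) (allSeqs-complete s))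
allSeqs-complete (true ∷ᵥ s)  = ∈-++⁺ʳ _ (∈-map⁺ (true ∷ᵥ_) (allSeqs-complete s))

IsPrefix-drop₁ : ∀ {u b t} → IsPrefix u (b ∷ t) → IsPrefix (drop 1 u) t
IsPrefix-drop₁ {[]}    _        = _ , refl
IsPrefix-drop₁ {_ ∷ _} (v , eq) = v , proj₂ (∷-injective eq)

module DisjTree {Φ : FSet} {Ξ : ℕ → Formula × Formula}
                {α : List Bool → Formula} {Φs : List Bool → FSet}
                {Ξs : List Bool → ℕ → Formula × Formula}
                (T : IsDisjTree Φ Ξ α Φs Ξs) where
  open IsDisjTree T

  Φs-child : ∀ r b φ → Φs (r ∷ʳ b) φ ⇔ (Φs r φ ⊎ φ ≡ α (r ∷ʳ b))
  Φs-child r b with step r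
  ... | _ , _ , _ , _ , _ , Φs-step , _ = Φs-step b

  α-split : ∀ r → Φs r ⊢ α (r ∷ʳ false) ∨ α (r ∷ʳ true)
  α-split r with step r
  ... | _ , Φs⊢Ξ , _ , α-left , α-right , _ rewrite α-left | α-right = Φs⊢Ξ

  α-derivable : ∀ r → Φs r ⊢ α r
  α-derivable r with reverseView r
  ... | []          = subst (Φs [] ⊢_) (sym α-root) ⇒-refl
  ... | s ∶ _ ∶ʳ b = hyp (proj₂ (Φs-child s b (α (s ∷ʳ b))) (inj₂ refl))

  α-parent-derivable : ∀ r b → Φs (r ∷ʳ b) ⊢ α r
  α-parent-derivable r b = ⊢-mono (λ φ → proj₂ (Φs-child r b φ) ∘ inj₁) (α-derivable r)

  α-child-prefix : ∀ r b {u t} → IsPrefix u (b ∷ t) →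
                   Φs (r ∷ʳ b) ⊢ α ((r ∷ʳ b) ++ drop 1 u) ⇒ α (r ++ u)
  α-child-prefix r b {[]} _ rewrite ++-identityʳ r = ⇒-const (α-parent-derivable r b)
  α-child-prefix r b {c ∷ u} (_ , eq) with refl ← proj₁ (∷-injective eq)
    rewrite ++-assoc r (b ∷ []) u = ⇒-refl

  ⋁-prefixes : ∀ k r (f : Vec Bool k → List Bool) → (∀ s → IsPrefix (f s) (toList s)) →
               Φs r ⊢ ⋁ (map (λ s → α (r ++ f s)) (allSeqs k))
  ⋁-prefixes zero r f f-prefix
    rewrite ++-conicalˡ (f []ᵥ) _ (proj₂ (f-prefix []ᵥ)) | ++-identityʳ r = α-derivable r
  ⋁-prefixes (suc k) r f f-prefix = ∨-elim (branch false) (branch true) (α-split r)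
    where
    target : Formula
    target = ⋁ (map (λ s → α (r ++ f s)) (allSeqs (suc k)))

    branch : ∀ b → Φs r ⊢ α (r ∷ʳ b) ⇒ target
    branch b = deduction (λ φ → proj₁ (Φs-child r b φ)) (mp (⋁-elim members⇒target) IH)
      where
      f-tail : Vec Bool k → List Bool
      f-tail = drop 1 ∘ f ∘ (b ∷ᵥ_)

      IH : Φs (r ∷ʳ b) ⊢ ⋁ (map (λ s → α ((r ∷ʳ b) ++ f-tail s)) (allSeqs k))
      IH = ⋁-prefixes k (r ∷ʳ b) f-tail (IsPrefix-drop₁ ∘ f-prefix ∘ (b ∷ᵥ_))

      members⇒target : All (λ φ → Φs (r ∷ʳ b) ⊢ φ ⇒ target)
                           (map (λ s → α ((r ∷ʳ b) ++ f-tail s)) (allSeqs k))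
      members⇒target = All.map⁺ (All.universal member⇒target _)
        where
        member⇒target : ∀ s → Φs (r ∷ʳ b) ⊢ α ((r ∷ʳ b) ++ f-tail s) ⇒ target
        member⇒target s = ⇒-trans (α-child-prefix r b (f-prefix (b ∷ᵥ s)))
                                  (⋁-intro (∈-map⁺ _ (allSeqs-complete (b ∷ᵥ s))))

-- Exhaustiveness of Ξ is what makes the tree exist.
lemma12 : (Φ : FSet) (Ξ : ℕ → Formula × Formula)
          → (∀ p → ∃ λ n → Ξ n ≡ p)
          → (α : List Bool → Formula) (Φs : List Bool → FSet)
            (Ξs : List Bool → ℕ → Formula × Formula)
          → IsDisjTree Φ Ξ α Φs Ξs
          → (k : ℕ) (r : List Bool) (f : Vec Bool k → List Bool)
          → (∀ s → IsPrefix (f s) (toList s))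
          → Φs r ⊢ ⋁ (map (λ s → α (r ++ f s)) (allSeqs k))
lemma12 _ _ _ _ _ _ T = DisjTree.⋁-prefixes T
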